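{- Let $\mathcal{M}$ and $\mathcal{N}$ be two almost-moon polyominoes such that $\mathcal{N}$ is obtained from $\mathcal{M}$ by interchanging two adjacent rows $\mathcal{R}_s$ and $\mathcal{R}_l$, where $\mathcal{R}_s$ is strictly shorter than $\mathcal{R}_l$, and assume neither polyomino has an exceptional row other than these two. For a 01-filling $M$ of $\mathcal{M}$, let $\alpha$ be the filling of $\mathcal{R}_s$, $\beta$ the filling of the cells of $\mathcal{R}_l$ lying in the columns of $\mathcal{R}_s$, and $\gamma,\delta$ the fillings of the parts of $\mathcal{R}_l$ to the left and to the right of these columns (possibly empty), so that the filling of $\mathcal{R}_l$ read left to right is the concatenation $\gamma\beta\delta$. Let $f_{\mathcal{M},\mathcal{N}}(M)$ be the filling of $\mathcal{N}$ that agrees with $M$ on all rows other than $\mathcal{R}_s,\mathcal{R}_l$, in which the row $\mathcal{R}_s$ of $\mathcal{N}$ is filled with $\beta$ and the row $\mathcal{R}_l$ of $\mathcal{N}$ is filled with $\gamma\alpha\delta$. Then for every 01-filling $M$ of $\mathcal{M}$, $|\mathrm{ne}(M)-\mathrm{ne}(f_{\mathcal{M},\mathcal{N}}(M))|\le 1$.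
   Context: A polyomino is a finite set of cells $(i,j)\in\mathbb{Z}^2$, $i$ the column coordinate and $j$ the row coordinate; rows/columns are the sets of cells with fixed $j$/fixed $i$, lengths are numbers of cells. Two rows are comparable if the set of column coordinates of one contains that of the other. A row $\mathcal{R}$ is exceptional if there is a row above and a row below $\mathcal{R}$, both longer than $\mathcal{R}$. An almost-moon polyomino is a polyomino whose rows are connected and pairwise comparable, with at most one exceptional row. Interchanging two adjacent rows means moving the cells of one row to the vertical position of the other and vice versa, keeping column coordinates. An ne-chain of size $k$ in a 01-filling of a polyomino $\mathcal{P}$ is a set of $k$ cells $(i_1,j_1),\dots,(i_k,j_k)$ filled with 1, $i_1<\dots<i_k$, $j_1<\dots<j_k$, such that all cells $(i_r,j_s)$, $1\le r,s\le k$, lie in $\mathcal{P}$; $\mathrm{ne}(M)$ is the maximal size of an ne-chain in $M$. -}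

module Defs where

open import Data.Bool using (Bool; true; false)
open import Data.Nat as ℕ using (ℕ)
open import Data.Integer as ℤ using (ℤ; +_; _-_; ∣_∣)
open import Data.Product using (_×_; _,_; proj₁; proj₂; ∃; ∃-syntax)
open import Data.Product.Properties using (≡-dec)
open import Data.Sum using (_⊎_)
open import Data.List using (List; length; filter)
open import Data.List.Relation.Unary.All using (All)
open import Data.List.Relation.Unary.Linked using (Linked)
open import Data.List.Relation.Unary.Unique.Propositional using (Unique)
open import Data.List.Membership.Propositional using (_∈_)
open import Data.List.Membership.DecPropositional (≡-dec ℤ._≟_ ℤ._≟_) using (_∈?_)
open import Relation.Nullary using (yes; no; ¬_)
open import Relation.Binary.PropositionalEquality using (_≡_)

Cell : Set
Cell = ℤ × ℤ

col : Cell → ℤ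
col = proj₁

rowOf : Cell → ℤ
rowOf = proj₂

record Polyomino : Set where
  field
    cells  : List Cell
    nodup  : Unique cells
open Polyomino public

_∈P_ : Cell → Polyomino → Set
c ∈P P = c ∈ cells P

rowCells : Polyomino → ℤ → List Cell
rowCells P j = filter (λ c → rowOf c ℤ.≟ j) (cells P)

rowLength : Polyomino → ℤ → ℕ
rowLength P j = length (rowCells P j)

IsRow : Polyomino → ℤ → Set
IsRow P j = ∃[ i ] ((i , j) ∈P P)

RowsConnected : Polyomino → Set
RowsConnected P = ∀ j i₁ i i₂ → (i₁ , j) ∈P P → (i₂ , j) ∈P P →
  i₁ ℤ.≤ i → i ℤ.≤ i₂ → (i , j) ∈P P

RowSubset : Polyomino → ℤ → ℤ → Set
RowSubset P j j' = ∀ i → (i , j) ∈P P → (i , j') ∈P P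

RowsComparable : Polyomino → Set
RowsComparable P = ∀ j j' → IsRow P j → IsRow P j' →
  RowSubset P j j' ⊎ RowSubset P j' j

Exceptional : Polyomino → ℤ → Set
Exceptional P j = IsRow P j ×
  (∃[ j₁ ] (j ℤ.< j₁ × rowLength P j ℕ.< rowLength P j₁)) ×
  (∃[ j₂ ] (j₂ ℤ.< j × rowLength P j ℕ.< rowLength P j₂))

AlmostMoon : Polyomino → Set
AlmostMoon P = RowsConnected P × RowsComparable P ×
  (∀ j j' → Exceptional P j → Exceptional P j' → j ≡ j')

swapIdx : ℤ → ℤ → ℤ → ℤ
swapIdx a b j with j ℤ.≟ a | j ℤ.≟ b
... | yes _ | _     = b
... | no _  | yes _ = a
... | no _  | no _  = j

Interchange : Polyomino → Polyomino → ℤ → ℤ → Set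
Interchange M N a b = ∀ i j →
  ((i , j) ∈P N → (i , swapIdx a b j) ∈P M) ×
  ((i , swapIdx a b j) ∈P M → (i , j) ∈P N)

Adjacent : ℤ → ℤ → Set
Adjacent a b = (b ≡ a ℤ.+ + 1) ⊎ (a ≡ b ℤ.+ + 1)

-- a 01-filling (only values on cells of the polyomino are relevant)
Filling : Set
Filling = Cell → Bool

_≺_ : Cell → Cell → Set
c ≺ d = (col c ℤ.< col d) × (rowOf c ℤ.< rowOf d)

record NEChain (P : Polyomino) (F : Filling) (k : ℕ) : Set where
  field
    chain      : List Cell
    size       : length chain ≡ k
    increasing : Linked _≺_ chain
    filled     : All (λ c → F c ≡ true) chain
    rectangle  : All (λ r → All (λ s → (col r , rowOf s) ∈P P) chain) chain

IsNe : Polyomino → Filling → ℕ → Set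
IsNe P F n = NEChain P F n × (∀ k → NEChain P F k → k ℕ.≤ n)

-- The map f_{M,N}: rows a (short row R_s in M) and b (long row R_l in M).
-- In N, row b carries the columns of R_s, filled with β = M restricted to
-- row b in those columns (unchanged values); row a carries the columns of R_l,
-- filled with γ α δ: α = M's row a on the columns of R_s, and γ, δ = M's row b
-- on the remaining columns.
fMN : Polyomino → ℤ → ℤ → Filling → Filling
fMN M a b F (i , j) with j ℤ.≟ a
... | no _ with j ℤ.≟ b
...   | yes _ = F (i , b)
...   | no _  = F (i , j)
fMN M a b F (i , j) | yes _ with (i , a) ∈? cells M
...   | yes _ = F (i , a)
...   | no _  = F (i , b)

module Submission where

open import Defs
open import Data.Nat using (ℕ; _≤_; _∸_; suc; z≤n; s≤s) renaming (_<_ to _<ℕ_)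
import Data.Nat.Properties as ℕ
open import Data.Integer as ℤ using (ℤ; +_; _-_; ∣_∣)
import Data.Integer.Properties as ℤ
open import Data.Integer.Tactic.RingSolver using (solve-∀)
open import Data.Product using (_,_; proj₁; proj₂)
open import Data.Product.Properties using (≡-dec)
open import Data.Sum using (_⊎_; inj₁; inj₂)
open import Data.Empty using (⊥-elim)
open import Data.List using (List; []; _∷_; length; filter; map)
import Data.List.Properties as List
open import Data.List.Relation.Unary.All as All using (All)
open import Data.List.Relation.Unary.Any as Any using (here; there)
open import Data.List.Relation.Unary.AllPairs using (AllPairs; _∷_)
open import Data.List.Relation.Unary.Unique.Propositional using (Unique)
import Data.List.Relation.Unary.Unique.Propositional.Properties as Unique
import Data.List.Relation.Unary.Linked.Properties as Linked
open import Data.List.Relation.Binary.Subset.Propositional using (_⊆_)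
open import Data.List.Membership.Propositional using (_∈_)
open import Data.List.Membership.Propositional.Properties using (∈-filter⁺; ∈-filter⁻; ∈-map⁻)
open import Data.List.Membership.DecPropositional (≡-dec ℤ._≟_ ℤ._≟_) using (_∈?_)
open import Relation.Nullary using (yes; no; ¬?)
open import Relation.Unary using (Decidable)
open import Relation.Binary.Definitions using (DecidableEquality)
open import Relation.Binary.PropositionalEquality

-- An ne-chain meets each row at most once, so deleting one row from it loses at
-- most one cell.  Since the rows are comparable, the columns of the short row lie
-- among those of the long one.  Hence, away from the long row of M, every cell and
-- every 1 of M is also a cell and a 1 of f(M) in N (the short row of M moves into
-- the long row of N), and away from the short row of N, every cell and every 1 of
-- f(M) already is one of M.  Thus ne(M) ≤ ne(f(M)) + 1 and ne(f(M)) ≤ ne(M) + 1.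

≺-trans : ∀ {c d e} → c ≺ d → d ≺ e → c ≺ e
≺-trans (c<d , c↑d) (d<e , d↑e) = ℤ.<-trans c<d d<e , ℤ.<-trans c↑d d↑e

offRow? : (r : ℤ) → Decidable (λ c → rowOf c ≢ r)
offRow? r c = ¬? (rowOf c ℤ.≟ r)

length≤suc-length-offRow : ∀ r {cs} → AllPairs _≺_ cs →
  length cs ≤ suc (length (filter (offRow? r) cs))
length≤suc-length-offRow r {[]} _ = z≤n
length≤suc-length-offRow r {c ∷ cs} (c≺cs ∷ ≺cs) with rowOf c ℤ.≟ r
... | no _ = s≤s (length≤suc-length-offRow r ≺cs)
... | yes refl = s≤s (ℕ.≤-reflexive (sym (cong length (List.filter-all (offRow? r) above))))
  where
  above : All (λ d → rowOf d ≢ rowOf c) cs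
  above = All.map (λ (_ , c↑d) d≡c → ℤ.<-irrefl (sym d≡c) c↑d) c≺cs

module _ {P Q : Polyomino} {F G : Filling} (r : ℤ)
  (P⊆Q : ∀ c → rowOf c ≢ r → c ∈P P → c ∈P Q)
  (F≡G : ∀ c → rowOf c ≢ r → c ∈P P → F c ≡ G c) where

  NEChain-offRow : ∀ {k} (ch : NEChain P F k) →
    NEChain Q G (length (filter (offRow? r) (NEChain.chain ch)))
  NEChain-offRow ch = record
    { chain = filter (offRow? r) chain
    ; size = refl
    ; increasing = Linked.filter⁺ (offRow? r) ≺-trans increasing
    ; filled = All.tabulate λ c∈ → let (c∈ch , c∉r) = ∈-filter⁻ (offRow? r) c∈ in
        trans (sym (F≡G _ c∉r (∈P c∈ch))) (All.lookup filled c∈ch)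
    ; rectangle = All.tabulate λ c∈ → All.tabulate λ d∈ →
        let (c∈ch , _) = ∈-filter⁻ (offRow? r) c∈ in
        let (d∈ch , d∉r) = ∈-filter⁻ (offRow? r) d∈ in
        P⊆Q _ d∉r (All.lookup (All.lookup rectangle c∈ch) d∈ch)
    }
    where
    open NEChain ch
    ∈P : ∀ {c} → c ∈ chain → c ∈P P
    ∈P c∈ = All.lookup (All.lookup rectangle c∈) c∈

  ne≤suc : ∀ {m n} → NEChain P F m → (∀ k → NEChain Q G k → k ≤ n) → m ≤ suc n
  ne≤suc {m} {n} ch ne-max = begin
    m                                         ≡⟨ size ⟨
    length chain                              ≤⟨ length≤suc-length-offRow r increasing′ ⟩
    suc (length (filter (offRow? r) chain))   ≤⟨ s≤s (ne-max _ (NEChain-offRow ch)) ⟩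
    suc n                                     ∎
    where
    open ℕ.≤-Reasoning
    open NEChain ch
    increasing′ : AllPairs _≺_ chain
    increasing′ = Linked.Linked⇒AllPairs ≺-trans increasing

module _ {A : Set} (_≟_ : DecidableEquality A) where

  length-mono-⊆ : ∀ {xs ys : List A} → Unique xs → xs ⊆ ys → length xs ≤ length ys
  length-mono-⊆ {[]} _ _ = z≤n
  length-mono-⊆ {x ∷ xs} {ys} (x∉xs ∷ !xs) x∷xs⊆ys =
    ℕ.<-≤-trans (s≤s (length-mono-⊆ !xs xs⊆ys-x))
                (List.filter-notAll ≢x? ys (Any.map (λ x≡y y≢x → y≢x (sym x≡y)) (x∷xs⊆ys (here refl))))
    where
    ≢x? : Decidable (_≢ x)
    ≢x? y = ¬? (y ≟ x)
    xs⊆ys-x : xs ⊆ filter ≢x? ys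
    xs⊆ys-x z∈ = ∈-filter⁺ ≢x? (x∷xs⊆ys (there z∈)) (λ z≡x → All.lookup x∉xs z∈ (sym z≡x))

i+[j-i]≡j : ∀ i j → i ℤ.+ (j - i) ≡ j
i+[j-i]≡j = solve-∀

i+j-j≡i : ∀ i j → i ℤ.+ j - j ≡ i
i+j-j≡i = solve-∀

shiftRow : ℤ → Cell → Cell
shiftRow d (i , j) = i , j ℤ.+ d

shiftRow-injective : ∀ d {c c′} → shiftRow d c ≡ shiftRow d c′ → c ≡ c′
shiftRow-injective d {i , j} {i′ , j′} eq = cong₂ _,_ (cong proj₁ eq) (begin
  j             ≡⟨ i+j-j≡i j d ⟨
  j ℤ.+ d - d   ≡⟨ cong (_- d) (cong proj₂ eq) ⟩
  j′ ℤ.+ d - d  ≡⟨ i+j-j≡i j′ d ⟩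
  j′            ∎)
  where open ≡-Reasoning

-- Translating row j vertically onto row j′ is injective on all cells, so it
-- turns the duplicate-free row j into a duplicate-free sublist of row j′.
rowLength-mono : ∀ P {j j′} → RowSubset P j j′ → rowLength P j ≤ rowLength P j′
rowLength-mono P {j} {j′} j⊆j′ =
  subst (_≤ rowLength P j′) (List.length-map (shiftRow (j′ - j)) (rowCells P j))
    (length-mono-⊆ (≡-dec ℤ._≟_ ℤ._≟_) shifted-unique shifted⊆row-j′)
  where
  j+[j′-j]≡j′ : j ℤ.+ (j′ - j) ≡ j′
  j+[j′-j]≡j′ = i+[j-i]≡j j j′
  shifted-unique : Unique (map (shiftRow (j′ - j)) (rowCells P j))
  shifted-unique = Unique.map⁺ (shiftRow-injective (j′ - j))
    (Unique.filter⁺ (λ c → rowOf c ℤ.≟ j) (nodup P))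
  shifted⊆row-j′ : map (shiftRow (j′ - j)) (rowCells P j) ⊆ rowCells P j′
  shifted⊆row-j′ c∈ with ∈-map⁻ (shiftRow (j′ - j)) c∈
  ... | (i , k) , c∈row-j , refl with ∈-filter⁻ (λ c → rowOf c ℤ.≟ j) {xs = cells P} c∈row-j
  ...   | c∈P , refl = ∈-filter⁺ (λ c → rowOf c ℤ.≟ j′)
          (subst (λ t → (i , t) ∈P P) (sym j+[j′-j]≡j′) (j⊆j′ i c∈P)) j+[j′-j]≡j′

shorter⇒RowSubset : ∀ P {a b} → RowsComparable P → IsRow P a → IsRow P b →
  rowLength P a <ℕ rowLength P b → RowSubset P a b
shorter⇒RowSubset P {a} {b} comparable a-row b-row a<b with comparable a b a-row b-row
... | inj₁ a⊆b = a⊆b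
... | inj₂ b⊆a = ⊥-elim (ℕ.<⇒≱ a<b (rowLength-mono P b⊆a))

module Interchanged (M N : Polyomino) (a b : ℤ)
  (a⊆b : RowSubset M a b) (interchange : Interchange M N a b) where

  ∈M⇒∈N : ∀ c → rowOf c ≢ b → c ∈P M → c ∈P N
  ∈M⇒∈N (i , j) j≢b c∈M = proj₂ (interchange i j) (moved c∈M)
    where
    moved : (i , j) ∈P M → (i , swapIdx a b j) ∈P M
    moved c∈M with j ℤ.≟ a | j ℤ.≟ b
    ... | yes refl | _     = a⊆b i c∈M
    ... | no _     | yes e = ⊥-elim (j≢b e)
    ... | no _     | no _  = c∈M

  ∈N⇒∈M : ∀ c → rowOf c ≢ a → c ∈P N → c ∈P M
  ∈N⇒∈M (i , j) j≢a c∈N = unmoved (proj₁ (interchange i j) c∈N)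
    where
    unmoved : (i , swapIdx a b j) ∈P M → (i , j) ∈P M
    unmoved c∈M with j ℤ.≟ a | j ℤ.≟ b
    ... | yes e | _        = ⊥-elim (j≢a e)
    ... | no _  | yes refl = a⊆b i c∈M
    ... | no _  | no _     = c∈M

fMN-offRow-long : ∀ M a b F c → rowOf c ≢ b → c ∈P M → F c ≡ fMN M a b F c
fMN-offRow-long M a b F (i , j) j≢b c∈M with j ℤ.≟ a
... | no _ with j ℤ.≟ b
...   | yes e = ⊥-elim (j≢b e)
...   | no _  = refl
fMN-offRow-long M a b F (i , j) j≢b c∈M | yes refl with (i , j) ∈? cells M
...   | yes _ = refl
...   | no c∉M = ⊥-elim (c∉M c∈M)

fMN-offRow-short : ∀ M a b F c → rowOf c ≢ a → fMN M a b F c ≡ F c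
fMN-offRow-short M a b F (i , j) j≢a with j ℤ.≟ a
... | yes e = ⊥-elim (j≢a e)
... | no _ with j ℤ.≟ b
...   | yes refl = refl
...   | no _     = refl

∸≤1 : ∀ {m n} → m ≤ suc n → m ∸ n ≤ 1
∸≤1 {n = n} m≤1+n = ℕ.≤-trans (ℕ.∸-monoˡ-≤ n m≤1+n) (ℕ.≤-reflexive (ℕ.m+n∸n≡m 1 n))

∣m-n∣≤1 : ∀ {m n} → m ≤ suc n → n ≤ suc m → ∣ + m - + n ∣ ≤ 1
∣m-n∣≤1 {m} {n} m≤1+n n≤1+m rewrite ℤ.[+m]-[+n]≡m⊖n m n with ℕ.≤-total m n
... | inj₁ m≤n = subst (_≤ 1) (sym (ℤ.∣⊖∣-≤ m≤n)) (∸≤1 n≤1+m)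
... | inj₂ n≤m = subst (_≤ 1) (sym (trans (ℤ.∣m⊖n∣≡∣n⊖m∣ m n) (ℤ.∣⊖∣-≤ n≤m))) (∸≤1 m≤1+n)

lemma7 : (M N : Polyomino) (a b : ℤ) →
    AlmostMoon M → AlmostMoon N →
    Adjacent a b → IsRow M a → IsRow M b →
    Interchange M N a b →
    rowLength M a <ℕ rowLength M b →
    (∀ j → Exceptional M j → (j ≡ a) ⊎ (j ≡ b)) →
    (∀ j → Exceptional N j → (j ≡ a) ⊎ (j ≡ b)) →
    (F : Filling) (m n : ℕ) → IsNe M F m → IsNe N (fMN M a b F) n →
    ∣ + m - + n ∣ ≤ 1
lemma7 M N a b (_ , comparable , _) _ _ a-row b-row interchange a<b _ _ F m n
  (chainM , maxM) (chainN , maxN) =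
  ∣m-n∣≤1 (ne≤suc b ∈M⇒∈N (fMN-offRow-long M a b F) chainM maxN)
          (ne≤suc a ∈N⇒∈M (λ c c∉a _ → fMN-offRow-short M a b F c c∉a) chainN maxM)
  where
  open Interchanged M N a b (shorter⇒RowSubset M comparable a-row b-row a<b) interchange
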